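{- For every tree $T$ with at least $2$ vertices, $\phi(T)\le\frac12\big(|\mathit{Deg}_{\ge2}(T)|+|\mathit{Supp}(T)|\big)$.
   Context: $\phi(T)$ is the size of a maximum matching of $T$. $\mathit{Deg}_{\ge2}(T)$ is the set of vertices of degree at least $2$; $\mathit{Supp}(T)$ is the set of support vertices, i.e., vertices adjacent to at least one leaf (vertex of degree $1$). -}

module Defs where

open import Data.Nat using (ℕ; zero; suc; _+_; _*_; _≤_; _≤?_)
open import Data.Fin using (Fin)
open import Data.Bool using (Bool; true; false; T)
open import Data.Bool.Properties using (T?)
open import Data.List using (List; []; _∷_; length; filter; concatMap; last)
open import Data.List.Relation.Unary.All using (All)
open import Data.List.Relation.Unary.Any using (any?)
open import Data.List.Relation.Unary.Unique.Propositional using (Unique)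
open import Data.List.Relation.Binary.Pointwise using () 
open import Data.List.Relation.Unary.Linked using (Linked)
open import Data.Maybe using (Maybe; just; nothing)
open import Data.Product using (_×_; _,_; Σ; ∃)
open import Data.Fin.Base using ()
open import Data.List.Base using (allFin)
open import Relation.Binary.PropositionalEquality using (_≡_)
open import Relation.Nullary using (¬_)

record Graph (n : ℕ) : Set where
  field
    adj   : Fin n → Fin n → Bool
    sym   : ∀ u v → adj u v ≡ adj v u
    irrefl : ∀ v → adj v v ≡ false
open Graph public

Adj : ∀ {n} → Graph n → Fin n → Fin n → Set
Adj G u v = T (adj G u v)

data Walk {n} (G : Graph n) : Fin n → Fin n → Set where
  [] : ∀ {v} → Walk G v v
  _∷_ : ∀ {u w v} → Adj G u w → Walk G w v → Walk G u v

Connected : ∀ {n} → Graph n → Set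
Connected G = ∀ u v → Walk G u v

-- A cycle: a list of at least 3 pairwise distinct vertices v₀ … v_k,
-- consecutive ones adjacent, and v_k adjacent to v₀.
record Cycle {n} (G : Graph n) : Set where
  field
    first  : Fin n
    second : Fin n
    rest   : List (Fin n)
    lastV  : Fin n
    distinct : Unique (first ∷ second ∷ rest Data.List.++ (lastV ∷ []))
    chain    : Linked (Adj G) (first ∷ second ∷ rest Data.List.++ (lastV ∷ []))
    closing  : Adj G lastV first

Acyclic : ∀ {n} → Graph n → Set
Acyclic G = ¬ Cycle G

IsTree : ∀ {n} → Graph n → Set
IsTree G = Connected G × Acyclic G

deg : ∀ {n} → Graph n → Fin n → ℕ
deg {n} G v = length (filter (λ u → T? (adj G v u)) (allFin n))

Deg≥2 : ∀ {n} → Graph n → List (Fin n)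
Deg≥2 {n} G = filter (λ v → 2 ≤? deg G v) (allFin n)

Supp : ∀ {n} → Graph n → List (Fin n)
Supp {n} G = filter (λ v → any? (λ u → T? (adj G v u) Relation.Nullary.×-dec (deg G u Data.Nat.≟ 1)) (allFin n)) (allFin n)

-- A matching: a list of edges whose endpoints are pairwise distinct
-- (so the edges are distinct and pairwise vertex-disjoint).
endpoints : ∀ {n} → List (Fin n × Fin n) → List (Fin n)
endpoints = concatMap (λ { (u , v) → u ∷ v ∷ [] })

record Matching {n} (G : Graph n) : Set where
  field
    edges    : List (Fin n × Fin n)
    areEdges : All (λ { (u , v) → Adj G u v }) edges
    disjoint : Unique (endpoints edges)
open Matching public

size : ∀ {n} {G : Graph n} → Matching G → ℕ
size M = length (edges M)

-- Each edge uv of a matching contributes two to the right-hand side: an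
-- endpoint of degree below 2 is a leaf (it has the neighbour on the other
-- side), so that neighbour is a support vertex.  As the endpoints of a
-- matching are pairwise distinct, summing over the edges gives the bound.
-- The argument works in every graph.
module Submission where

open import Defs
open import Data.Nat using (ℕ; _≤_; _*_; _+_)
open import Data.List using (length)

open import Data.Nat using (suc; z≤n; s≤s; s≤s⁻¹; _≤?_; _≟_)
open import Data.Nat.Properties
  using (≤-antisym; ≰⇒>; +-mono-≤; *-suc; +-commutativeSemigroup; module ≤-Reasoning)
open import Algebra.Properties.CommutativeSemigroup +-commutativeSemigroup using (interchange)
open import Data.Fin using (Fin)
open import Data.Bool using (T)
open import Data.Bool.Properties using (T?)
open import Data.List using (List; []; _∷_; _++_; filter; allFin)
open import Data.List.Properties using (length-++; length-++-sucʳ; filter-++)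
open import Data.List.Relation.Unary.All as All using (All; []; _∷_)
open import Data.List.Relation.Unary.Any using (Any; here; there; any?)
open import Data.List.Relation.Unary.AllPairs using (_∷_)
open import Data.List.Relation.Unary.Unique.Propositional using (Unique)
open import Data.List.Relation.Unary.Unique.Propositional.Properties
  using (Unique[x∷xs]⇒x∉xs) renaming (filter⁺ to Unique-filter⁺)
open import Data.List.Relation.Binary.Subset.Propositional using (_⊆_)
open import Data.List.Membership.Propositional using (_∈_; lose)
open import Data.List.Membership.Propositional.Properties
  using (∈-∃++; ∈-++⁻; ∈-++⁺ˡ; ∈-++⁺ʳ; ∈-filter⁺; ∈-filter⁻; ∈-allFin)
open import Data.Product using (_×_; _,_; proj₂)
open import Data.Sum using (inj₁; inj₂)
open import Function using (_∘_)
open import Level using (Level)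
open import Relation.Nullary using (yes; no; ¬_; contradiction; _×-dec_)
open import Relation.Unary using (Pred; Decidable)
open import Relation.Binary.PropositionalEquality
  using (_≡_; _≢_; refl; cong; cong₂; subst) renaming (sym to ≡-sym; trans to ≡-trans)

private
  variable
    a p q : Level
    A : Set a

count : {P : Pred A p} → Decidable P → List A → ℕ
count P? xs = length (filter P? xs)

∈-++-∷⁻ : ∀ {x y : A} us vs → y ∈ us ++ x ∷ vs → y ≢ x → y ∈ us ++ vs
∈-++-∷⁻ us vs y∈ y≢x with ∈-++⁻ us y∈
... | inj₁ y∈us         = ∈-++⁺ˡ y∈us
... | inj₂ (here y≡x)   = contradiction y≡x y≢x
... | inj₂ (there y∈vs) = ∈-++⁺ʳ us y∈vs

Unique-⊆⇒length≤ : ∀ {xs ys : List A} → Unique xs → xs ⊆ ys → length xs ≤ length ys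
Unique-⊆⇒length≤ {xs = []}     _                            _  = z≤n
Unique-⊆⇒length≤ {xs = x ∷ xs} x∷xs!@(_ ∷ xs!) x∷xs⊆ys
  with us , vs , refl ← ∈-∃++ (x∷xs⊆ys (here refl)) = begin
    suc (length xs)          ≤⟨ s≤s (Unique-⊆⇒length≤ xs! xs⊆us++vs) ⟩
    suc (length (us ++ vs))  ≡⟨ ≡-sym (length-++-sucʳ us x vs) ⟩
    length (us ++ x ∷ vs)    ∎
  where
  open ≤-Reasoning
  xs⊆us++vs : xs ⊆ us ++ vs
  xs⊆us++vs y∈xs = ∈-++-∷⁻ us vs (x∷xs⊆ys (there y∈xs))
    λ { refl → Unique[x∷xs]⇒x∉xs x∷xs! y∈xs }

count-≤-allFin : ∀ {n} {P : Pred (Fin n) p} (P? : Decidable P) {xs} →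
  Unique xs → count P? xs ≤ count P? (allFin n)
count-≤-allFin P? {xs} xs! = Unique-⊆⇒length≤ (Unique-filter⁺ P? xs!)
  λ y∈ → ∈-filter⁺ P? (∈-allFin _) (proj₂ (∈-filter⁻ P? {xs = xs} y∈))

count-pair-≥2 : {P : Pred A p} {Q : Pred A q} (P? : Decidable P) (Q? : Decidable Q) {x y : A} →
  (¬ P x → Q y) → (¬ P y → Q x) → 2 ≤ count P? (x ∷ y ∷ []) + count Q? (x ∷ y ∷ [])
count-pair-≥2 P? Q? {x} {y} ¬Px⇒Qy ¬Py⇒Qx with P? x
... | yes _ with P? y
...   | yes _ = s≤s (s≤s z≤n)
...   | no ¬Py with Q? x
...     | yes _  = s≤s (s≤s z≤n)
...     | no ¬Qx = contradiction (¬Py⇒Qx ¬Py) ¬Qx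
count-pair-≥2 P? Q? {x} {y} ¬Px⇒Qy ¬Py⇒Qx | no ¬Px with P? y
...   | yes _ with Q? x
...     | yes _ = s≤s (s≤s z≤n)
...     | no _ with Q? y
...       | yes _  = s≤s (s≤s z≤n)
...       | no ¬Qy = contradiction (¬Px⇒Qy ¬Px) ¬Qy
count-pair-≥2 P? Q? {x} {y} ¬Px⇒Qy ¬Py⇒Qx | no ¬Px | no ¬Py with Q? x
...     | no ¬Qx = contradiction (¬Py⇒Qx ¬Py) ¬Qx
...     | yes _ with Q? y
...       | yes _  = s≤s (s≤s z≤n)
...       | no ¬Qy = contradiction (¬Px⇒Qy ¬Px) ¬Qy

count-++ : {P : Pred A p} (P? : Decidable P) (xs ys : List A) →
  count P? (xs ++ ys) ≡ count P? xs + count P? ys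
count-++ P? xs ys = ≡-trans (cong length (filter-++ P? xs ys)) (length-++ (filter P? xs))

EdgeCovered : Pred A p → Pred A q → A × A → Set _
EdgeCovered P Q (u , v) = (¬ P u → Q v) × (¬ P v → Q u)

2*length≤count-endpoints : ∀ {n} {P : Pred (Fin n) p} {Q : Pred (Fin n) q}
  (P? : Decidable P) (Q? : Decidable Q) {es : List (Fin n × Fin n)} →
  All (EdgeCovered P Q) es → 2 * length es ≤ count P? (endpoints es) + count Q? (endpoints es)
2*length≤count-endpoints P? Q? [] = z≤n
2*length≤count-endpoints {n = n} P? Q? {(u , v) ∷ es} ((¬Pu⇒Qv , ¬Pv⇒Qu) ∷ covered) = begin
  2 * suc (length es)
    ≡⟨ *-suc 2 (length es) ⟩
  2 + 2 * length es
    ≤⟨ +-mono-≤ (count-pair-≥2 P? Q? ¬Pu⇒Qv ¬Pv⇒Qu) (2*length≤count-endpoints P? Q? covered) ⟩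
  (count P? uv + count Q? uv) + (count P? rest + count Q? rest)
    ≡⟨ interchange (count P? uv) _ _ _ ⟩
  (count P? uv + count P? rest) + (count Q? uv + count Q? rest)
    ≡⟨ ≡-sym (cong₂ _+_ (count-++ P? uv rest) (count-++ Q? uv rest)) ⟩
  count P? (uv ++ rest) + count Q? (uv ++ rest) ∎
  where
  open ≤-Reasoning
  uv rest : List (Fin n)
  uv   = u ∷ v ∷ []
  rest = endpoints es

∈⇒1≤length : ∀ {x : A} {xs} → x ∈ xs → 1 ≤ length xs
∈⇒1≤length (here _)  = s≤s z≤n
∈⇒1≤length (there _) = s≤s z≤n

module _ {n} (G : Graph n) where

  IsSupport : Pred (Fin n) _
  IsSupport v = Any (λ u → Adj G v u × deg G u ≡ 1) (allFin n)

  isSupport? : Decidable IsSupport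
  isSupport? v = any? (λ u → T? (adj G v u) ×-dec (deg G u ≟ 1)) (allFin n)

  deg≥2? : Decidable (λ v → 2 ≤ deg G v)
  deg≥2? v = 2 ≤? deg G v

  Adj-sym : ∀ {u v} → Adj G u v → Adj G v u
  Adj-sym {u} {v} = subst T (Graph.sym G u v)

  Adj⇒1≤deg : ∀ {u v} → Adj G u v → 1 ≤ deg G u
  Adj⇒1≤deg {u} {v} uv = ∈⇒1≤length (∈-filter⁺ (T? ∘ adj G u) (∈-allFin v) uv)

  Adj∧deg≱2⇒deg≡1 : ∀ {u v} → Adj G u v → ¬ 2 ≤ deg G u → deg G u ≡ 1
  Adj∧deg≱2⇒deg≡1 uv deg≱2 = ≤-antisym (s≤s⁻¹ (≰⇒> deg≱2)) (Adj⇒1≤deg uv)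

  Adj∧deg≱2⇒IsSupport : ∀ {u v} → Adj G u v → ¬ 2 ≤ deg G u → IsSupport v
  Adj∧deg≱2⇒IsSupport {u} uv deg≱2 = lose (∈-allFin u) (Adj-sym uv , Adj∧deg≱2⇒deg≡1 uv deg≱2)

  edgeCovered : ∀ {u v} → Adj G u v → EdgeCovered (λ w → 2 ≤ deg G w) IsSupport (u , v)
  edgeCovered uv = Adj∧deg≱2⇒IsSupport uv , Adj∧deg≱2⇒IsSupport (Adj-sym uv)

proposition5 : (n : ℕ) → 2 ≤ n → (T : Graph n) → IsTree T →
    (M : Matching T) → 2 * size M ≤ length (Deg≥2 T) + length (Supp T)
proposition5 n _ G _ M = begin
  2 * size M                              ≤⟨ 2*length≤count-endpoints (deg≥2? G) (isSupport? G) covered ⟩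
  count (deg≥2? G) ends + count (isSupport? G) ends
                                          ≤⟨ +-mono-≤ (count-≤-allFin (deg≥2? G) (disjoint M))
                                                      (count-≤-allFin (isSupport? G) (disjoint M)) ⟩
  length (Deg≥2 G) + length (Supp G)      ∎
  where
  open ≤-Reasoning
  ends : List (Fin n)
  ends = endpoints (edges M)
  covered : All (EdgeCovered (λ v → 2 ≤ deg G v) (IsSupport G)) (edges M)
  covered = All.map (edgeCovered G) (areEdges M)
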